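{- Let $H$ be a linear hypergraph and $\mathscr{H}$ a set of subhypergraphs of $H$ each of which is strongly induced in $H$ and such that any two distinct members of $\mathscr{H}$ have a clean intersection. Then $\mathrm{Girth}(H,\mathscr{H}^+)>(2,2)$.
   Context: Hypergraphs are pairs $(V,E)$ with $E$ a set of $k$-subsets of a finite set $V$; linear means two distinct edges share at most one vertex. A subhypergraph $F$ of $G$ is strongly induced if for every $e\in E(G)$ there is $f\in E(F)$ with $e\cap V(F)\subseteq f$. Two copies $F_\star,F_{\star\star}$ have a clean intersection if there are $e_\star\in E(F_\star)$, $e_{\star\star}\in E(F_{\star\star})$ with $V(F_\star)\cap V(F_{\star\star})=e_\star\cap e_{\star\star}$. For $e\in E(H)$, $e^+=(e,\{e\})$ and $\mathscr{H}^+=\mathscr{H}\cup\{e^+:e\in E(H)\}$. A cycle of copies is a cyclic sequence $F_1q_1\ldots F_nq_n$, $n\ge2$, with $F_i\in\mathscr{H}^+$, $F_i\ne F_{i+1}$, connectors distinct elements of $V(H)\cup E(H)$, a vertex $q_i$ in $V(F_i)\cap V(F_{i+1})$, an edge $q_i$ in $E(F_i)\cap E(F_{i+1})$. Index $i$ pure if $q_{i-1},q_i$ are of the same type (both vertices or both edges), mixed otherwise; order $=$ #pure$+\frac12$#mixed; $h(\mathscr{C})=(\text{order},n)$ ordered lexicographically. Tidy: (T1) no connectors $q_i,q_j$ with $q_i\in q_j$; (T2) for every edge $f$, $\{i:q_i$ vertex in $f\}\subseteq\{i_\star,i_\star+1\}$ for some $i_\star$. Master copy: a copy $F_\star$ of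 the cycle with edges $f_i\in E(F_\star)$ for each $i$ with $F_i\ne F_\star$ such that replacing these $F_i$ by $f_i^+$ yields a cycle of copies. $\mathrm{Girth}(H,\mathscr{H}^+)>(2,2)$ means every tidy cycle of copies $\mathscr{C}$ with $h(\mathscr{C})\le(2,2)$ has a master copy. -}

module Defs where

open import Data.Nat using (ℕ; zero; suc; _+_; _<_; _≤_)
open import Data.Nat.DivMod using (_mod_)
open import Data.Fin using (Fin; toℕ)
open import Data.Fin.Subset using (Subset; _∈_; _⊆_; _∩_; ∣_∣)
open import Data.Bool using (Bool; true; false; if_then_else_)
open import Data.Bool.Properties using () renaming (_≟_ to _≟B_)
open import Data.Vec.Properties using (≡-dec)
open import Data.List using (tabulate)
open import Data.Nat.ListAction using (sum)
open import Data.Product using (Σ; _×_; _,_)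
open import Data.Sum using (_⊎_; inj₁; inj₂)
open import Relation.Nullary using (¬_; does)
open import Relation.Binary.PropositionalEquality using (_≡_)

-- Hypergraphs on the ambient vertex universe Fin N.
-- V : the (finite) vertex set, E : the (finite) edge set, given by its
-- characteristic function on subsets of Fin N.

record Hyp (N : ℕ) : Set where
  constructor hyp
  field
    V : Subset N
    E : Subset N → Bool
open Hyp public

Edge : ∀ {N} → Hyp N → Subset N → Set
Edge G e = E G e ≡ true

_≟S_ : ∀ {N} (x y : Subset N) → _
_≟S_ = ≡-dec _≟B_

_≈H_ : ∀ {N} → Hyp N → Hyp N → Set
F ≈H G = (V F ≡ V G) × (∀ e → E F e ≡ E G e)

IsKGraph : ∀ {N} → ℕ → Hyp N → Set
IsKGraph k G = ∀ e → Edge G e → (e ⊆ V G) × (∣ e ∣ ≡ k)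

Linear : ∀ {N} → Hyp N → Set
Linear G = ∀ e f → Edge G e → Edge G f → ¬ (e ≡ f) → ∣ e ∩ f ∣ ≤ 1

SubHyp : ∀ {N} → ℕ → Hyp N → Hyp N → Set
SubHyp k H F = IsKGraph k F × (V F ⊆ V H) × (∀ e → Edge F e → Edge H e)

StronglyInduced : ∀ {N} → Hyp N → Hyp N → Set
StronglyInduced G F = ∀ e → Edge G e → Σ (Subset _) λ f → Edge F f × ((e ∩ V F) ⊆ f)

CleanIntersection : ∀ {N} → Hyp N → Hyp N → Set
CleanIntersection F₁ F₂ =
  Σ (Subset _) λ e₁ → Σ (Subset _) λ e₂ →
    Edge F₁ e₁ × Edge F₂ e₂ × (V F₁ ∩ V F₂ ≡ e₁ ∩ e₂)

plus : ∀ {N} → Subset N → Hyp N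
plus e = hyp e (λ f → does (f ≟S e))

InPlus : ∀ {N} → Hyp N → (Hyp N → Set) → Hyp N → Set
InPlus H ℋ G = ℋ G ⊎ Σ (Subset _) λ e → Edge H e × (G ≡ plus e)

next : ∀ {m} → Fin (suc (suc m)) → Fin (suc (suc m))
next {m} i = suc (toℕ i) mod (suc (suc m))

prev : ∀ {m} → Fin (suc (suc m)) → Fin (suc (suc m))
prev {m} i = (toℕ i + suc m) mod (suc (suc m))

Conn : ℕ → Set
Conn N = Fin N ⊎ Subset N

ConnOf : ∀ {N} → Hyp N → Conn N → Set
ConnOf H (inj₁ v) = v ∈ V H
ConnOf H (inj₂ e) = Edge H e

Links : ∀ {N} → Hyp N → Hyp N → Conn N → Set
Links F G (inj₁ v) = (v ∈ V F) × (v ∈ V G)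
Links F G (inj₂ e) = Edge F e × Edge G e

-- cycle of copies F₁ q₁ … Fₙ qₙ of length n = 2 + m
record Cycle {N : ℕ} (H : Hyp N) (ℋ : Hyp N → Set) (m : ℕ) : Set where
  field
    F    : Fin (suc (suc m)) → Hyp N
    Fin+ : ∀ i → InPlus H ℋ (F i)
    Fdif : ∀ i → ¬ (F i ≈H F (next i))
    q    : Fin (suc (suc m)) → Conn N
    qinj : ∀ i j → q i ≡ q j → i ≡ j
    qH   : ∀ i → ConnOf H (q i)
    qlk  : ∀ i → Links (F i) (F (next i)) (q i)
open Cycle public

isVertex : ∀ {N} → Conn N → Bool
isVertex (inj₁ _) = true
isVertex (inj₂ _) = false

sameType : ∀ {N} → Conn N → Conn N → Bool
sameType (inj₁ _) (inj₁ _) = true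
sameType (inj₂ _) (inj₂ _) = true
sameType _ _ = false

-- twice the order: pure indices count 2, mixed indices count 1
twiceOrder : ∀ {N H ℋ m} → Cycle {N} H ℋ m → ℕ
twiceOrder {m = m} C =
  sum (tabulate {n = suc (suc m)} λ i → if sameType (q C (prev i)) (q C i) then 2 else 1)

-- h(𝒞) = (order, n) ≤ (2,2) lexicographically
hLe22 : ∀ {N H ℋ m} → Cycle {N} H ℋ m → Set
hLe22 {m = m} C = (twiceOrder C < 4) ⊎ ((twiceOrder C ≡ 4) × (suc (suc m) ≤ 2))

Tidy : ∀ {N H ℋ m} → Cycle {N} H ℋ m → Set
Tidy {N} {H} {m = m} C =
  (∀ i j v e → q C i ≡ inj₁ v → q C j ≡ inj₂ e → ¬ (v ∈ e))
  ×
  (∀ f → Edge H f → Σ (Fin (suc (suc m))) λ i⋆ →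
     ∀ i v → q C i ≡ inj₁ v → v ∈ f → (i ≡ i⋆) ⊎ (i ≡ next i⋆))

MasterCopy : ∀ {N H ℋ m} → Cycle {N} H ℋ m → Set
MasterCopy {N} {H} {ℋ} {m} C =
  Σ (Fin (suc (suc m))) λ j →
  Σ (Cycle H ℋ m) λ C' →
    (∀ i → q C' i ≡ q C i) ×
    (∀ i → ((F C i ≈H F C j) → F C' i ≡ F C i)
         × (¬ (F C i ≈H F C j) →
              Σ (Subset N) λ f → Edge (F C j) f × (F C' i ≡ plus f)))

GirthGt22 : ∀ {N} → Hyp N → (Hyp N → Set) → Set
GirthGt22 H ℋ = ∀ m (C : Cycle H ℋ m) → Tidy C → hLe22 C → MasterCopy C

-- Every index of a cycle of copies contributes at least 1/2 to its order, and among three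
-- connectors of two types two consecutive ones have the same type, so cycles of length at
-- least 3 have order at least 2 and h(𝒞) ≤ (2,2) forces n = 2.
-- A 2-cycle is two distinct copies A, B ∈ ℋ⁺ sharing two distinct connectors. Linearity
-- rules out A, B both of the form e⁺; if B = b⁺, strong inducedness of A puts b in E(A); and
-- if A, B ∈ ℋ, linearity and uniformity force the two edges of their clean intersection to
-- be one edge e, through which both connectors pass. In each case some copy X of the cycle
-- contains an edge e ≠ X with both connectors linking X and e⁺, so X is a master copy.
module Submission where

open import Defs
open import Data.Nat using (ℕ; zero; suc; _+_; _≤_; _<_; z≤n; s≤s)
open import Data.Nat.Properties
  using (<⇒≱; ≤-trans; ≤-refl; suc-injective; +-mono-≤; m≤m+n)
open import Data.Fin using (Fin; zero; suc)
open import Data.Fin.Properties using (0≢1+n)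
open import Data.Fin.Subset using (Subset; _∈_; _⊆_; _∩_; ∣_∣; inside; outside; ⁅_⁆; _-_)
open import Data.Fin.Subset.Properties
  using (x∈p∩q⁺; p∩q⊆p; p∩q⊆q; x∈⁅y⁆⇒x≡y; ∣⁅x⁆∣≡1; p⊆q⇒∣p∣≤∣q∣; x∈p∧x≢y⇒x∈p-y;
         x∈p⇒∣p-x∣<∣p∣; drop-∷-⊆)
open import Data.Vec.Base using ([]; _∷_; here)
open import Data.List using (tabulate)
open import Data.Nat.ListAction using (sum)
open import Data.Bool using (true; false; if_then_else_)
open import Data.Product using (Σ; _×_; _,_; proj₁; proj₂)
open import Data.Sum using (_⊎_; inj₁; inj₂; [_,_]′)
open import Data.Empty using (⊥-elim)
open import Relation.Nullary using (¬_; yes; no)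
open import Relation.Nullary.Decidable using (dec-true)
open import Relation.Binary.PropositionalEquality
  using (_≡_; _≢_; refl; sym; trans; cong; subst)

x∈p∧y∈p∧x≢y⇒1<∣p∣ : ∀ {n} {p : Subset n} {x y} → x ∈ p → y ∈ p → x ≢ y → 1 < ∣ p ∣
x∈p∧y∈p∧x≢y⇒1<∣p∣ {p = p} {x} {y} x∈p y∈p x≢y =
  ≤-trans (s≤s 1≤∣p-x∣) (x∈p⇒∣p-x∣<∣p∣ x∈p)
  where
  ⁅y⁆⊆p-x : ⁅ y ⁆ ⊆ p - x
  ⁅y⁆⊆p-x z∈⁅y⁆ rewrite x∈⁅y⁆⇒x≡y y z∈⁅y⁆ = x∈p∧x≢y⇒x∈p-y y∈p (λ y≡x → x≢y (sym y≡x))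
  1≤∣p-x∣ : 1 ≤ ∣ p - x ∣
  1≤∣p-x∣ = subst (_≤ ∣ p - x ∣) (∣⁅x⁆∣≡1 y) (p⊆q⇒∣p∣≤∣q∣ ⁅y⁆⊆p-x)

p⊆q∧∣p∣≡∣q∣⇒p≡q : ∀ {n} {p q : Subset n} → p ⊆ q → ∣ p ∣ ≡ ∣ q ∣ → p ≡ q
p⊆q∧∣p∣≡∣q∣⇒p≡q {p = []}          {[]}          _   _ = refl
p⊆q∧∣p∣≡∣q∣⇒p≡q {p = outside ∷ p} {outside ∷ q} p⊆q ∣p∣≡∣q∣ =
  cong (outside ∷_) (p⊆q∧∣p∣≡∣q∣⇒p≡q (drop-∷-⊆ p⊆q) ∣p∣≡∣q∣)
p⊆q∧∣p∣≡∣q∣⇒p≡q {p = outside ∷ p} {inside ∷ q}  p⊆q ∣p∣≡∣q∣ =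
  ⊥-elim (<⇒≱ (s≤s (p⊆q⇒∣p∣≤∣q∣ (drop-∷-⊆ p⊆q))) (subst (_≤ ∣ p ∣) ∣p∣≡∣q∣ ≤-refl))
p⊆q∧∣p∣≡∣q∣⇒p≡q {p = inside ∷ p}  {outside ∷ q} p⊆q _ with () ← p⊆q here
p⊆q∧∣p∣≡∣q∣⇒p≡q {p = inside ∷ p}  {inside ∷ q}  p⊆q ∣p∣≡∣q∣ =
  cong (inside ∷_) (p⊆q∧∣p∣≡∣q∣⇒p≡q (drop-∷-⊆ p⊆q) (suc-injective ∣p∣≡∣q∣))

module _ {N : ℕ} where

  ≈H-refl : ∀ {A : Hyp N} → A ≈H A
  ≈H-refl = refl , λ _ → refl

  ≈H-sym : ∀ {A B : Hyp N} → A ≈H B → B ≈H A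
  ≈H-sym (V≡ , E≡) = sym V≡ , λ e → sym (E≡ e)

  ≈H-trans : ∀ {A B C : Hyp N} → A ≈H B → B ≈H C → A ≈H C
  ≈H-trans (V≡ , E≡) (V≡′ , E≡′) = trans V≡ V≡′ , λ e → trans (E≡ e) (E≡′ e)

  Edge-plus⇒≡ : ∀ {f} (e : Subset N) → Edge (plus e) f → f ≡ e
  Edge-plus⇒≡ {f} e f∈e⁺ with f ≟S e | f∈e⁺
  ... | yes f≡e | _ = f≡e
  ... | no _    | ()

  ≡⇒Edge-plus : ∀ {e f : Subset N} → f ≡ e → Edge (plus e) f
  ≡⇒Edge-plus {e} {f} = dec-true (f ≟S e)

  edge⊆edge⇒≡ : ∀ {k} {G : Hyp N} {e f} → IsKGraph k G → Edge G e → Edge G f → e ⊆ f → e ≡ f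
  edge⊆edge⇒≡ kG e∈G f∈G e⊆f =
    p⊆q∧∣p∣≡∣q∣⇒p≡q e⊆f (trans (proj₂ (kG _ e∈G)) (sym (proj₂ (kG _ f∈G))))

  edge≡V⇒≈plus : ∀ {k} {G : Hyp N} {e} → IsKGraph k G → Edge G e → V G ≡ e → G ≈H plus e
  edge≡V⇒≈plus {G = G} {e} kG e∈G VG≡e = VG≡e , E≡
    where
    E≡ : ∀ f → E G f ≡ E (plus e) f
    E≡ f with f ≟S e | E G f in EGf≡
    ... | yes refl | _     = trans (sym EGf≡) e∈G
    ... | no  f≢e  | true  = ⊥-elim (f≢e (edge⊆edge⇒≡ kG EGf≡ e∈G
                                           (λ x∈f → subst (_ ∈_) VG≡e (proj₁ (kG f EGf≡) x∈f))))
    ... | no  _    | false = refl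

  Links-sym : ∀ {A B : Hyp N} q → Links A B q → Links B A q
  Links-sym (inj₁ _) (v∈A , v∈B) = v∈B , v∈A
  Links-sym (inj₂ _) (g∈A , g∈B) = g∈B , g∈A

  SharedEdge : Hyp N → Hyp N → Set
  SharedEdge A B = Σ (Subset N) λ g → Edge A g × Edge B g

  TwoSharedVertices : Hyp N → Hyp N → Set
  TwoSharedVertices A B =
    Σ (Fin N) λ v → Σ (Fin N) λ w → v ≢ w × Links A B (inj₁ v) × Links A B (inj₁ w)

  links₂⇒SharedEdge⊎TwoSharedVertices : ∀ {A B : Hyp N} {q₀ q₁} → q₀ ≢ q₁ →
    Links A B q₀ → Links A B q₁ → SharedEdge A B ⊎ TwoSharedVertices A B
  links₂⇒SharedEdge⊎TwoSharedVertices {q₀ = inj₂ g} _ l₀ _ = inj₁ (g , l₀)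
  links₂⇒SharedEdge⊎TwoSharedVertices {q₀ = inj₁ _} {inj₂ g} _ _ l₁ = inj₁ (g , l₁)
  links₂⇒SharedEdge⊎TwoSharedVertices {q₀ = inj₁ v} {inj₁ w} q₀≢q₁ l₀ l₁ =
    inj₂ (v , w , (λ v≡w → q₀≢q₁ (cong inj₁ v≡w)) , l₀ , l₁)

  Links-through-edge : ∀ {k} {A B : Hyp N} {e} q → IsKGraph k A → IsKGraph k B → Edge A e →
    (∀ {x} → x ∈ V A → x ∈ V B → x ∈ e) → Links A B q → Links A (plus e) q
  Links-through-edge (inj₁ _) _ _ _ V∩V⊆e (v∈A , v∈B) = v∈A , V∩V⊆e v∈A v∈B
  Links-through-edge (inj₂ _) kA kB e∈A V∩V⊆e (g∈A , g∈B) =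
    g∈A , ≡⇒Edge-plus (edge⊆edge⇒≡ kA g∈A e∈A
                        (λ x∈g → V∩V⊆e (proj₁ (kA _ g∈A) x∈g) (proj₁ (kB _ g∈B) x∈g)))

  -- X is a master copy of a 2-cycle with connectors q₀, q₁ in which the other copy becomes e⁺.
  MasterEdge : Hyp N → Hyp N → Conn N → Conn N → Set
  MasterEdge H X q₀ q₁ = Σ (Subset N) λ e →
    Edge H e × Edge X e × ¬ X ≈H plus e × Links X (plus e) q₀ × Links X (plus e) q₁

  module _ {H : Hyp N} (lin : Linear H) where

    Linear⇒≡ : ∀ {e f x y} → Edge H e → Edge H f → x ≢ y →
               x ∈ e → x ∈ f → y ∈ e → y ∈ f → e ≡ f
    Linear⇒≡ {e} {f} e∈H f∈H x≢y x∈e x∈f y∈e y∈f with e ≟S f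
    ... | yes e≡f = e≡f
    ... | no  e≢f = ⊥-elim (<⇒≱ (x∈p∧y∈p∧x≢y⇒1<∣p∣ (x∈p∩q⁺ (x∈e , x∈f)) (x∈p∩q⁺ (y∈e , y∈f)) x≢y)
                                 (lin e f e∈H f∈H e≢f))

    plus-links₂⇒≡ : ∀ {a b q₀ q₁} → Edge H a → Edge H b → q₀ ≢ q₁ →
      Links (plus a) (plus b) q₀ → Links (plus a) (plus b) q₁ → a ≡ b
    plus-links₂⇒≡ {a} {b} a∈H b∈H q₀≢q₁ l₀ l₁ with links₂⇒SharedEdge⊎TwoSharedVertices q₀≢q₁ l₀ l₁
    ... | inj₁ (g , g∈a⁺ , g∈b⁺) = trans (sym (Edge-plus⇒≡ {g} a g∈a⁺)) (Edge-plus⇒≡ {g} b g∈b⁺)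
    ... | inj₂ (v , w , v≢w , (v∈a , v∈b) , (w∈a , w∈b)) =
      Linear⇒≡ a∈H b∈H v≢w v∈a v∈b w∈a w∈b

    induced-plus-links₂⇒Edge : ∀ {X b q₀ q₁} → (∀ e → Edge X e → Edge H e) →
      StronglyInduced H X → Edge H b → q₀ ≢ q₁ →
      Links X (plus b) q₀ → Links X (plus b) q₁ → Edge X b
    induced-plus-links₂⇒Edge {X} {b} X⊆H si b∈H q₀≢q₁ l₀ l₁
      with links₂⇒SharedEdge⊎TwoSharedVertices q₀≢q₁ l₀ l₁
    ... | inj₁ (g , g∈X , g∈b⁺) = subst (Edge X) (Edge-plus⇒≡ b g∈b⁺) g∈X
    ... | inj₂ (v , w , v≢w , (v∈X , v∈b) , (w∈X , w∈b)) with si b b∈H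
    ...   | f , f∈X , b∩X⊆f =
      subst (Edge X) (Linear⇒≡ (X⊆H f f∈X) b∈H v≢w
                        (b∩X⊆f (x∈p∩q⁺ (v∈b , v∈X))) v∈b (b∩X⊆f (x∈p∩q⁺ (w∈b , w∈X))) w∈b)
            f∈X

    cleanEdges-links₂⇒≡ : ∀ {k} {A B : Hyp N} {e₀ e₁ q₀ q₁} → IsKGraph k A → IsKGraph k B →
      Edge H e₀ → Edge H e₁ → Edge A e₀ → Edge B e₁ → V A ∩ V B ≡ e₀ ∩ e₁ → q₀ ≢ q₁ →
      Links A B q₀ → Links A B q₁ → e₀ ≡ e₁
    cleanEdges-links₂⇒≡ {e₀ = e₀} {e₁} kA kB e₀∈H e₁∈H e₀∈A e₁∈B V∩V≡ q₀≢q₁ l₀ l₁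
      with links₂⇒SharedEdge⊎TwoSharedVertices q₀≢q₁ l₀ l₁
    ... | inj₁ (g , g∈A , g∈B) =
      trans (sym (edge⊆edge⇒≡ kA g∈A e₀∈A (λ x∈g → p∩q⊆p e₀ e₁ (g⊆e₀∩e₁ x∈g))))
            (edge⊆edge⇒≡ kB g∈B e₁∈B (λ x∈g → p∩q⊆q e₀ e₁ (g⊆e₀∩e₁ x∈g)))
      where
      g⊆e₀∩e₁ : g ⊆ e₀ ∩ e₁
      g⊆e₀∩e₁ x∈g =
        subst (_ ∈_) V∩V≡ (x∈p∩q⁺ (proj₁ (kA _ g∈A) x∈g , proj₁ (kB _ g∈B) x∈g))
    ... | inj₂ (v , w , v≢w , v∈A∩B , w∈A∩B) =
      Linear⇒≡ e₀∈H e₁∈H v≢w (p∩q⊆p e₀ e₁ v∈e₀∩e₁) (p∩q⊆q e₀ e₁ v∈e₀∩e₁)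
                                  (p∩q⊆p e₀ e₁ w∈e₀∩e₁) (p∩q⊆q e₀ e₁ w∈e₀∩e₁)
      where
      v∈e₀∩e₁ = subst (_ ∈_) V∩V≡ (x∈p∩q⁺ v∈A∩B)
      w∈e₀∩e₁ = subst (_ ∈_) V∩V≡ (x∈p∩q⁺ w∈A∩B)

  common-edge⇒MasterEdge : ∀ {k} {H A B : Hyp N} {e q₀ q₁} → IsKGraph k A → IsKGraph k B →
    Edge H e → Edge A e → Edge B e → (∀ {x} → x ∈ V A → x ∈ V B → x ∈ e) → ¬ A ≈H B →
    Links A B q₀ → Links A B q₁ → MasterEdge H A q₀ q₁ ⊎ MasterEdge H B q₀ q₁
  common-edge⇒MasterEdge {A = A} {B} {e} {q₀} {q₁} kA kB e∈H e∈A e∈B V∩V⊆e A≉B l₀ l₁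
    with V A ≟S e | V B ≟S e
  ... | no VA≢e | _ =
    inj₁ (e , e∈H , e∈A , (λ A≈e⁺ → VA≢e (proj₁ A≈e⁺)) ,
          Links-through-edge q₀ kA kB e∈A V∩V⊆e l₀ , Links-through-edge q₁ kA kB e∈A V∩V⊆e l₁)
  ... | yes _ | no VB≢e =
    inj₂ (e , e∈H , e∈B , (λ B≈e⁺ → VB≢e (proj₁ B≈e⁺)) ,
          Links-through-edge q₀ kB kA e∈B V∩V⊆e′ (Links-sym q₀ l₀) ,
          Links-through-edge q₁ kB kA e∈B V∩V⊆e′ (Links-sym q₁ l₁))
    where
    V∩V⊆e′ : ∀ {x} → x ∈ V B → x ∈ V A → x ∈ e
    V∩V⊆e′ x∈B x∈A = V∩V⊆e x∈A x∈B
  ... | yes VA≡e | yes VB≡e =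
    ⊥-elim (A≉B (≈H-trans (edge≡V⇒≈plus kA e∈A VA≡e) (≈H-sym (edge≡V⇒≈plus kB e∈B VB≡e))))

module _ {N k : ℕ} {H : Hyp N} {ℋ : Hyp N → Set} (lin : Linear H)
         (sub : ∀ F → ℋ F → SubHyp k H F) (si : ∀ F → ℋ F → StronglyInduced H F)
         (cl : ∀ F G → ℋ F → ℋ G → ¬ (F ≈H G) → CleanIntersection F G) where

  copies-links₂⇒MasterEdge : ∀ {A B q₀ q₁} → ℋ A → ℋ B → ¬ A ≈H B → q₀ ≢ q₁ →
    Links A B q₀ → Links A B q₁ → MasterEdge H A q₀ q₁ ⊎ MasterEdge H B q₀ q₁
  copies-links₂⇒MasterEdge {A} {B} A∈ℋ B∈ℋ A≉B q₀≢q₁ l₀ l₁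
    with e , e′ , e∈A , e′∈B , V∩V≡ ← cl A B A∈ℋ B∈ℋ A≉B =
    common-edge⇒MasterEdge {H = H} kA kB e∈H e∈A (subst (Edge B) (sym e≡e′) e′∈B)
      (λ x∈A x∈B → p∩q⊆p e e′ (subst (_ ∈_) V∩V≡ (x∈p∩q⁺ (x∈A , x∈B)))) A≉B l₀ l₁
    where
    kA = proj₁ (sub A A∈ℋ)
    kB = proj₁ (sub B B∈ℋ)
    e∈H = proj₂ (proj₂ (sub A A∈ℋ)) e e∈A
    e≡e′ : e ≡ e′
    e≡e′ = cleanEdges-links₂⇒≡ {H = H} lin kA kB e∈H (proj₂ (proj₂ (sub B B∈ℋ)) e′ e′∈B) e∈A e′∈B
                               V∩V≡ q₀≢q₁ l₀ l₁

  links₂⇒MasterEdge : ∀ {A B q₀ q₁} → InPlus H ℋ A → InPlus H ℋ B → ¬ A ≈H B → q₀ ≢ q₁ →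
    Links A B q₀ → Links A B q₁ → MasterEdge H A q₀ q₁ ⊎ MasterEdge H B q₀ q₁
  links₂⇒MasterEdge (inj₁ A∈ℋ) (inj₁ B∈ℋ) = copies-links₂⇒MasterEdge A∈ℋ B∈ℋ
  links₂⇒MasterEdge {A} (inj₁ A∈ℋ) (inj₂ (b , b∈H , refl)) A≉b⁺ q₀≢q₁ l₀ l₁ =
    inj₁ (b , b∈H , induced-plus-links₂⇒Edge {H = H} lin (proj₂ (proj₂ (sub A A∈ℋ))) (si A A∈ℋ)
                      b∈H q₀≢q₁ l₀ l₁ ,
          A≉b⁺ , l₀ , l₁)
  links₂⇒MasterEdge {B = B} {q₀} {q₁} (inj₂ (a , a∈H , refl)) (inj₁ B∈ℋ) a⁺≉B q₀≢q₁ l₀ l₁ =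
    inj₂ (a , a∈H , induced-plus-links₂⇒Edge {H = H} lin (proj₂ (proj₂ (sub B B∈ℋ))) (si B B∈ℋ)
                      a∈H q₀≢q₁ l₀′ l₁′ ,
          (λ B≈a⁺ → a⁺≉B (≈H-sym B≈a⁺)) , l₀′ , l₁′)
    where
    l₀′ = Links-sym q₀ l₀
    l₁′ = Links-sym q₁ l₁
  links₂⇒MasterEdge (inj₂ (a , a∈H , refl)) (inj₂ (b , b∈H , refl)) a⁺≉b⁺ q₀≢q₁ l₀ l₁
    with refl ← plus-links₂⇒≡ {H = H} lin a∈H b∈H q₀≢q₁ l₀ l₁ = ⊥-elim (a⁺≉b⁺ ≈H-refl)

module _ {N : ℕ} {H : Hyp N} {ℋ : Hyp N → Set} where

  cycle₂ : ∀ {A B} → InPlus H ℋ A → InPlus H ℋ B → ¬ A ≈H B → (q : Fin 2 → Conn N) →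
    (∀ i j → q i ≡ q j → i ≡ j) → (∀ i → ConnOf H (q i)) →
    Links A B (q zero) → Links A B (q (suc zero)) → Cycle H ℋ 0
  cycle₂ {A} {B} A⁺ B⁺ A≉B q q-inj q∈H l₀ l₁ = record
    { F = F′ ; Fin+ = F′⁺ ; Fdif = F′≉next ; q = q ; qinj = q-inj ; qH = q∈H ; qlk = F′-links }
    where
    F′ : Fin 2 → Hyp N
    F′ zero       = A
    F′ (suc zero) = B
    F′⁺ : ∀ i → InPlus H ℋ (F′ i)
    F′⁺ zero       = A⁺
    F′⁺ (suc zero) = B⁺
    F′≉next : ∀ i → ¬ F′ i ≈H F′ (next i)
    F′≉next zero       = A≉B
    F′≉next (suc zero) = λ B≈A → A≉B (≈H-sym B≈A)
    F′-links : ∀ i → Links (F′ i) (F′ (next i)) (q i)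
    F′-links zero       = l₀
    F′-links (suc zero) = Links-sym (q (suc zero)) l₁

  masterCopy₂ : (C : Cycle H ℋ 0) (j : Fin 2) →
    MasterEdge H (F C j) (q C zero) (q C (suc zero)) → MasterCopy C
  masterCopy₂ C zero (e , e∈H , e∈F₀ , F₀≉e⁺ , l₀ , l₁) =
    zero , cycle₂ (Fin+ C zero) (inj₂ (e , e∈H , refl)) F₀≉e⁺ (q C) (qinj C) (qH C) l₀ l₁ ,
    (λ _ → refl) ,
    λ { zero       → (λ _ → refl) , (λ F₀≉F₀ → ⊥-elim (F₀≉F₀ ≈H-refl))
      ; (suc zero) → (λ F₁≈F₀ → ⊥-elim (Fdif C (suc zero) F₁≈F₀)) , (λ _ → e , e∈F₀ , refl) }
  masterCopy₂ C (suc zero) (e , e∈H , e∈F₁ , F₁≉e⁺ , l₀ , l₁) =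
    suc zero ,
    cycle₂ (inj₂ (e , e∈H , refl)) (Fin+ C (suc zero)) (λ e⁺≈F₁ → F₁≉e⁺ (≈H-sym e⁺≈F₁))
           (q C) (qinj C) (qH C) (Links-sym (q C zero) l₀) (Links-sym (q C (suc zero)) l₁) ,
    (λ _ → refl) ,
    λ { zero       → (λ F₀≈F₁ → ⊥-elim (Fdif C zero F₀≈F₁)) , (λ _ → e , e∈F₁ , refl)
      ; (suc zero) → (λ _ → refl) , (λ F₁≉F₁ → ⊥-elim (F₁≉F₁ ≈H-refl)) }

n≤sum-tabulate : ∀ {n} (f : Fin n → ℕ) → (∀ i → 1 ≤ f i) → n ≤ sum (tabulate f)
n≤sum-tabulate {zero}  f _   = z≤n
n≤sum-tabulate {suc n} f 1≤f = +-mono-≤ (1≤f zero) (n≤sum-tabulate (λ i → f (suc i)) (λ i → 1≤f (suc i)))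

module _ {N : ℕ} {H : Hyp N} {ℋ : Hyp N → Set} where

  length≤twiceOrder : ∀ {m} (C : Cycle H ℋ m) → 2 + m ≤ twiceOrder C
  length≤twiceOrder C = n≤sum-tabulate _ (λ i → 1≤weight (sameType (q C (prev i)) (q C i)))
    where
    1≤weight : ∀ b → 1 ≤ (if b then 2 else 1)
    1≤weight true  = s≤s z≤n
    1≤weight false = s≤s z≤n

  4≤twiceOrder : ∀ {m} (C : Cycle H ℋ (suc m)) → 4 ≤ twiceOrder C
  4≤twiceOrder {zero}  C = three-connectors (q C zero) (q C (suc zero)) (q C (suc (suc zero)))
    where
    three-connectors : ∀ a b c → 4 ≤ (if sameType c a then 2 else 1) +
                                     ((if sameType a b then 2 else 1) +
                                      ((if sameType b c then 2 else 1) + 0))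
    three-connectors (inj₁ _) (inj₁ _) (inj₁ _) = s≤s (s≤s (s≤s (s≤s z≤n)))
    three-connectors (inj₁ _) (inj₁ _) (inj₂ _) = s≤s (s≤s (s≤s (s≤s z≤n)))
    three-connectors (inj₁ _) (inj₂ _) (inj₁ _) = s≤s (s≤s (s≤s (s≤s z≤n)))
    three-connectors (inj₁ _) (inj₂ _) (inj₂ _) = s≤s (s≤s (s≤s (s≤s z≤n)))
    three-connectors (inj₂ _) (inj₁ _) (inj₁ _) = s≤s (s≤s (s≤s (s≤s z≤n)))
    three-connectors (inj₂ _) (inj₁ _) (inj₂ _) = s≤s (s≤s (s≤s (s≤s z≤n)))
    three-connectors (inj₂ _) (inj₂ _) (inj₁ _) = s≤s (s≤s (s≤s (s≤s z≤n)))
    three-connectors (inj₂ _) (inj₂ _) (inj₂ _) = s≤s (s≤s (s≤s (s≤s z≤n)))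
  4≤twiceOrder {suc m} C = ≤-trans (m≤m+n 4 m) (length≤twiceOrder C)

  long-cycle⇒¬hLe22 : ∀ {m} (C : Cycle H ℋ (suc m)) → ¬ hLe22 C
  long-cycle⇒¬hLe22 C (inj₁ order<4)          = <⇒≱ order<4 (4≤twiceOrder C)
  long-cycle⇒¬hLe22 C (inj₂ (_ , s≤s (s≤s ())))

lemma4p13 : (N k : ℕ) (H : Hyp N) (ℋ : Hyp N → Set) →
    IsKGraph k H → Linear H →
    (∀ F → ℋ F → SubHyp k H F) →
    (∀ F → ℋ F → StronglyInduced H F) →
    (∀ F G → ℋ F → ℋ G → ¬ (F ≈H G) → CleanIntersection F G) →
    GirthGt22 H ℋ
lemma4p13 N k H ℋ _ lin sub si cl zero C _ _ =
  [ masterCopy₂ C zero , masterCopy₂ C (suc zero) ]′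
    (links₂⇒MasterEdge lin sub si cl (Fin+ C zero) (Fin+ C (suc zero)) (Fdif C zero)
       (λ q₀≡q₁ → 0≢1+n (qinj C zero (suc zero) q₀≡q₁))
       (qlk C zero) (Links-sym (q C (suc zero)) (qlk C (suc zero))))
lemma4p13 N k H ℋ _ lin sub si cl (suc m) C _ hLe22 = ⊥-elim (long-cycle⇒¬hLe22 C hLe22)
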